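{- For every condition $b:S\to\mathbb{B}$, loop body $P:S\to(E,S)\mathsf{itree}$ and state $s\in S$: $$\mathrm{retvals}((\mathsf{while}\ b\ P)(s))=\{s'\mid(\neg b(s)\wedge s=s')\vee(\exists tr.\,b(s)\wedge(b,s)\vdash P\xrightarrow{tr}s'\wedge\neg b(s'))\}.$$
   Context: Fix a type $E$ of events; $(E,S)\mathsf{itree}$ is the codatatype with constructors $\mathsf{Ret}\,r$, $\mathsf{Sil}\,P$ ($\tau P$), $\mathsf{Vis}\,F$ ($F:E\rightharpoonup(E,S)\mathsf{itree}$ partial). Bind: $\mathsf{Ret}\,r\mathbin{>\!\!>\!\!=}K=K\,r$, $\tau P'\mathbin{>\!\!>\!\!=}K=\tau(P'\mathbin{>\!\!>\!\!=}K)$, $\mathsf{Vis}\,F\mathbin{>\!\!>\!\!=}K=\mathsf{Vis}(\lambda e\in\mathrm{dom}(F)\bullet F(e)\mathbin{>\!\!>\!\!=}K)$. $\mathsf{while}\ b\ P\ s=$ if $b(s)$ then $\tau(P(s)\mathbin{>\!\!>\!\!=}\mathsf{while}\ b\ P)$ else $\mathsf{Ret}\,s$ (corecursive). Transition relation: least relation with $P\xrightarrow{[]}P$; $P\xrightarrow{tr}P'\Rightarrow\tau P\xrightarrow{tr}P'$; $e\in\mathrm{dom}(F)\wedge F(e)\xrightarrow{tr}P'\Rightarrow\mathsf{Vis}\,F\xrightarrow{e\#tr}P'$. $\mathrm{retvals}(Q)=\{x\mid\exists tr.\,Q\xrightarrow{tr}\mathsf{Ret}\,x\}$. Iteration chains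 $s\vdash P\leadsto^{chn}s'$: least relation with $s\vdash P\leadsto^{[]}s$, and if $P(s)\xrightarrow{tr}\mathsf{Ret}\,s_0$ and $s_0\vdash P\leadsto^{chn}s_1$ then $s\vdash P\leadsto^{(tr,s_0)\#chn}s_1$; $\mathit{states}(chn)$ is the set of second components and $\mathit{trace}(chn)$ the concatenation of first components. $(b,s)\vdash P\xrightarrow{tr}s'$ holds iff there are $chn,s_0,tr_0$ with $b(s)$, $s\vdash P\leadsto^{chn}s_0$, $b(t)$ for all $t\in\mathit{states}(chn)$, $P(s_0)\xrightarrow{tr_0}\mathsf{Ret}\,s'$ and $tr=\mathit{trace}(chn)\mathbin{@}tr_0$. -}

module Defs where

open import Data.Bool using (Bool; true; false; if_then_else_)
open import Data.Maybe using (Maybe; just; nothing)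
import Data.Maybe as Maybe
open import Data.Sum using (_⊎_; inj₁; inj₂)
open import Data.List using (List; []; _∷_; _++_; map; concat)
open import Data.List.Relation.Unary.All using (All)
open import Data.Product using (Σ; _×_; _,_; proj₁; proj₂; ∃; ∃-syntax)
open import Relation.Binary.PropositionalEquality using (_≡_)

-- The subtrees of a tree are the carrier states reachable by `step`.

data ITreeF (E S X : Set) : Set where
  Ret : S → ITreeF E S X
  Sil : X → ITreeF E S X
  Vis : (E → Maybe X) → ITreeF E S X

record ITree (E S : Set) : Set₁ where
  field
    Carrier : Set
    step    : Carrier → ITreeF E S Carrier
    root    : Carrier
open ITree public

at : ∀ {E S} (P : ITree E S) → Carrier P → ITree E S
at P x = record { Carrier = Carrier P ; step = step P ; root = x }

module _ {E : Set} where

  -- Bind (given for reference):  Ret r >>= K = K r,  τ P' >>= K = τ (P' >>= K),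
  -- Vis F >>= K = Vis (λ e ∈ dom F • F e >>= K).
  bind : {R S : Set} → ITree E R → (R → ITree E S) → ITree E S
  bind {R} {S} P K = record { Carrier = C ; step = st ; root = inj₁ (root P) }
    where
      C : Set
      C = Carrier P ⊎ Σ R (λ r → Carrier (K r))
      lift : ∀ r → ITreeF E S (Carrier (K r)) → ITreeF E S C
      lift r (Ret s) = Ret s
      lift r (Sil y) = Sil (inj₂ (r , y))
      lift r (Vis F) = Vis (λ e → Maybe.map (λ y → inj₂ (r , y)) (F e))
      st : C → ITreeF E S C
      st (inj₁ x) with step P x
      ... | Ret r = lift r (step (K r) (root (K r)))
      ... | Sil x' = Sil (inj₁ x')
      ... | Vis F = Vis (λ e → Maybe.map inj₁ (F e))
      st (inj₂ (r , y)) = lift r (step (K r) y)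

  -- while b P s = if b s then τ (P s >>= while b P) else Ret s   (corecursive).
  -- Carrier: inj₁ s  stands for  while b P s,
  --          inj₂ (s , x)  stands for  (subtree x of P s) >>= while b P.
  -- The step function is exactly the unfolding of the defining equation
  -- together with the bind equations above.
  while : {S : Set} → (S → Bool) → (S → ITree E S) → S → ITree E S
  while {S} b P s = record { Carrier = C ; step = st ; root = inj₁ s }
    where
      C : Set
      C = S ⊎ Σ S (λ t → Carrier (P t))
      loop : S → ITreeF E S C
      loop t = if b t then Sil (inj₂ (t , root (P t))) else Ret t
      st : C → ITreeF E S C
      st (inj₁ t) = loop t
      st (inj₂ (t , x)) with step (P t) x
      ... | Ret t' = loop t'
      ... | Sil x' = Sil (inj₂ (t , x'))
      ... | Vis F = Vis (λ e → Maybe.map (λ y → inj₂ (t , y)) (F e))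

  data Step {S X : Set} (st : X → ITreeF E S X) : X → List E → X → Set where
    refl→ : ∀ {x} → Step st x [] x
    sil→  : ∀ {x x' tr y} → st x ≡ Sil x' → Step st x' tr y → Step st x tr y
    vis→  : ∀ {x F e x' tr y} → st x ≡ Vis F → F e ≡ just x' →
            Step st x' tr y → Step st x (e ∷ tr) y

  _─[_]→Ret_ : {S : Set} → ITree E S → List E → S → Set
  P ─[ tr ]→Ret x = ∃[ y ] (Step (step P) (root P) tr y × step P y ≡ Ret x)

  retvals : {S : Set} → ITree E S → S → Set
  retvals Q x = ∃[ tr ] (Q ─[ tr ]→Ret x)

  data _⊢_↝[_]_ {S : Set} : S → (S → ITree E S) → List (List E × S) → S → Set₁ where
    chain-nil  : ∀ {s P} → s ⊢ P ↝[ [] ] s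
    chain-cons : ∀ {s P tr s₀ chn s₁} → P s ─[ tr ]→Ret s₀ →
                 s₀ ⊢ P ↝[ chn ] s₁ → s ⊢ P ↝[ (tr , s₀) ∷ chn ] s₁

  states : {S : Set} → List (List E × S) → List S
  states chn = map proj₂ chn

  trace : {S : Set} → List (List E × S) → List E
  trace chn = concat (map proj₁ chn)

  IterTrans : {S : Set} → (S → Bool) → S → (S → ITree E S) → List E → S → Set₁
  IterTrans {S} b s P tr s' =
    ∃[ chn ] ∃[ s₀ ] ∃[ tr₀ ]
      (b s ≡ true × s ⊢ P ↝[ chn ] s₀ × All (λ t → b t ≡ true) (states chn)
       × P s₀ ─[ tr₀ ]→Ret s' × tr ≡ trace chn ++ tr₀)

module Submission where

-- A terminating run of  while b P s  with  b s  true is a sequence of complete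
-- runs of the body: each returns a state on which b is true, except the last,
-- whose return value fails b and is the value of the loop. Such runs are read
-- off the paths of the while-tree because it contains a copy of every subtree of
-- each body, and they are exactly the iteration chains followed by a final run.

open import Defs
open import Data.Bool using (Bool; true; false)
open import Data.List using (List; []; _∷_; _++_)
open import Data.List.Properties using (++-assoc)
open import Data.List.Relation.Unary.All using (All; []; _∷_)
open import Data.Maybe using (just; nothing)
open import Data.Maybe.Properties using (map-just)
import Data.Maybe as Maybe
open import Data.Product using (_×_; ∃-syntax; _,_)
open import Data.Sum using (_⊎_; inj₁; inj₂)
open import Function.Bundles using (_⇔_; mk⇔; module Equivalence)
open import Relation.Binary.PropositionalEquality using (_≡_; refl; sym; subst)

module _ {E S X : Set} {st : X → ITreeF E S X} where

  Step-++ : ∀ {x y z tr₁ tr₂} →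
            Step st x tr₁ y → Step st y tr₂ z → Step st x (tr₁ ++ tr₂) z
  Step-++ refl→        q = q
  Step-++ (sil→ e p)   q = sil→ e (Step-++ p q)
  Step-++ (vis→ e f p) q = vis→ e f (Step-++ p q)

module Iteration {E S : Set} (b : S → Bool) (P : S → ITree E S) where

  -- Exits t p tr x: the loop, resumed at subtree p of the body P t, returns x
  -- after the events tr.
  data Exits : (t : S) → Carrier (P t) → List E → S → Set where
    done  : ∀ {t p tr x} →
            at (P t) p ─[ tr ]→Ret x → b x ≡ false → Exits t p tr x
    again : ∀ {t p t₁ tr₁ tr₂ x} →
            at (P t) p ─[ tr₁ ]→Ret t₁ → b t₁ ≡ true →
            Exits t₁ (root (P t₁)) tr₂ x → Exits t p (tr₁ ++ tr₂) x

  Exits-prepend : ∀ {t p q tr₀ tr x} →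
                  Step (step (P t)) p tr₀ q → Exits t q tr x → Exits t p (tr₀ ++ tr) x
  Exits-prepend pq (done (y , qy , r) bx) = done (y , Step-++ pq qy , r) bx
  Exits-prepend {tr₀ = tr₀} pq (again {tr₁ = tr₁} {tr₂} (y , qy , r) bt rest) =
    subst (λ tr → Exits _ _ tr _) (++-assoc tr₀ tr₁ tr₂)
          (again (y , Step-++ pq qy , r) bt rest)

  Exits⇒b-false : ∀ {t p tr x} → Exits t p tr x → b x ≡ false
  Exits⇒b-false (done _ bx)       = bx
  Exits⇒b-false (again _ _ rest) = Exits⇒b-false rest

  chain⇒Exits : ∀ {u chn s₀ tr₀ x} →
                u ⊢ P ↝[ chn ] s₀ → All (λ t → b t ≡ true) (states chn) →
                P s₀ ─[ tr₀ ]→Ret x → b x ≡ false →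
                Exits u (root (P u)) (trace chn ++ tr₀) x
  chain⇒Exits chain-nil [] ret bx = done ret bx
  chain⇒Exits {tr₀ = tr₀} (chain-cons {tr = tr} {chn = chn} ret₁ ch) (bt ∷ bts) ret bx =
    subst (λ tr' → Exits _ _ tr' _) (sym (++-assoc tr (trace chn) tr₀))
          (again ret₁ bt (chain⇒Exits ch bts ret bx))

  Exits⇒chain : ∀ {u tr x} → Exits u (root (P u)) tr x →
                ∃[ chn ] ∃[ s₀ ] ∃[ tr₀ ]
                  (u ⊢ P ↝[ chn ] s₀ × All (λ t → b t ≡ true) (states chn)
                   × P s₀ ─[ tr₀ ]→Ret x × tr ≡ trace chn ++ tr₀)
  Exits⇒chain (done ret _) = [] , _ , _ , chain-nil , [] , ret , refl
  Exits⇒chain (again {t₁ = t₁} {tr₁} ret bt rest) with Exits⇒chain rest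
  ... | chn , s₀ , tr₀ , ch , bts , ret₀ , refl =
    (tr₁ , t₁) ∷ chn , s₀ , tr₀ , chain-cons ret ch , bt ∷ bts , ret₀ ,
    sym (++-assoc tr₁ (trace chn) tr₀)

  IterTrans⇔Exits : ∀ {s tr x} → b s ≡ true →
                    (IterTrans b s P tr x × b x ≡ false) ⇔ Exits s (root (P s)) tr x
  IterTrans⇔Exits bs = mk⇔
    (λ { ((_ , _ , _ , _ , ch , bts , ret , refl) , bx) → chain⇒Exits ch bts ret bx })
    (λ ex → let chn , s₀ , tr₀ , ch , bts , ret , eq = Exits⇒chain ex
            in (chn , s₀ , tr₀ , bs , ch , bts , ret , eq) , Exits⇒b-false ex)

module WhileRuns {E S : Set} (b : S → Bool) (P : S → ITree E S) (s : S) where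

  open Iteration b P

  W : ITree E S
  W = while b P s

  body : (t : S) → Carrier (P t) → Carrier W
  body t p = inj₂ (t , p)

  enter : ∀ {t} → b t ≡ true → step W (inj₁ t) ≡ Sil (body t (root (P t)))
  enter bt rewrite bt = refl

  leave : ∀ {t} → b t ≡ false → step W (inj₁ t) ≡ Ret t
  leave bt rewrite bt = refl

  reenter : ∀ {t p t₁} → step (P t) p ≡ Ret t₁ → b t₁ ≡ true →
            step W (body t p) ≡ Sil (body t₁ (root (P t₁)))
  reenter r bt rewrite r | bt = refl

  finish : ∀ {t p x} → step (P t) p ≡ Ret x → b x ≡ false → step W (body t p) ≡ Ret x
  finish r bx rewrite r | bx = refl

  Step-body : ∀ {t p q tr} → Step (step (P t)) p tr q → Step (step W) (body t p) tr (body t q)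
  Step-body refl→ = refl→
  Step-body {t} {p} (sil→ {x' = p'} e q) = sil→ sil-body (Step-body q)
    where sil-body : step W (body t p) ≡ Sil (body t p')
          sil-body rewrite e = refl
  Step-body {t} {p} (vis→ {F = F} e f q) =
    vis→ vis-body (map-just {f = body t} f) (Step-body q)
    where vis-body : step W (body t p) ≡ Vis (λ ev → Maybe.map (body t) (F ev))
          vis-body rewrite e = refl

  Exits⇒ret : ∀ {t p tr x} → Exits t p tr x → at W (body t p) ─[ tr ]→Ret x
  Exits⇒ret (done (y , py , r) bx) = body _ y , Step-body py , finish r bx
  Exits⇒ret (again (y , py , r) bt rest) =
    let z , wz , rz = Exits⇒ret rest
    in z , Step-++ (Step-body py) (sil→ (reenter r bt) wz) , rz

  ret⇒Exits : ∀ {t p tr y x} →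
              Step (step W) (body t p) tr y → step W y ≡ Ret x → Exits t p tr x
  ret⇒Exits {t} {p} refl→ r with step (P t) p in e
  ret⇒Exits refl→ r    | Ret t₁ with b t₁ in bt
  ret⇒Exits refl→ refl | Ret t₁ | false = done (_ , refl→ , e) bt
  ret⇒Exits refl→ ()   | Ret t₁ | true
  ret⇒Exits refl→ ()   | Sil _
  ret⇒Exits refl→ ()   | Vis _
  ret⇒Exits {t} {p} (sil→ _ q) r with step (P t) p in e
  ret⇒Exits (sil→ _ q)    r | Ret t₁ with b t₁ in bt
  ret⇒Exits (sil→ () q)   r | Ret t₁ | false
  ret⇒Exits (sil→ refl q) r | Ret t₁ | true = again (_ , refl→ , e) bt (ret⇒Exits q r)
  ret⇒Exits (sil→ refl q) r | Sil _ = Exits-prepend (sil→ e refl→) (ret⇒Exits q r)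
  ret⇒Exits (sil→ () q)   r | Vis _
  ret⇒Exits {t} {p} (vis→ _ _ q) r with step (P t) p in e
  ret⇒Exits (vis→ _ _ q)  r | Ret t₁ with b t₁
  ret⇒Exits (vis→ () _ q) r | Ret t₁ | false
  ret⇒Exits (vis→ () _ q) r | Ret t₁ | true
  ret⇒Exits (vis→ () _ q) r | Sil _
  ret⇒Exits (vis→ {e = ev} refl f q) r | Vis F with F ev in eF
  ret⇒Exits (vis→ refl refl q) r | Vis F | just _ =
    Exits-prepend (vis→ e eF refl→) (ret⇒Exits q r)
  ret⇒Exits (vis→ refl () q) r | Vis F | nothing

  retvals-while⇔ : ∀ {t x} → retvals (at W (inj₁ t)) x ⇔
                   ((b t ≡ false × t ≡ x) ⊎ (b t ≡ true × ∃[ tr ] Exits t (root (P t)) tr x))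
  retvals-while⇔ {t} = mk⇔ to from
    where
    to : ∀ {x} → retvals (at W (inj₁ t)) x →
         (b t ≡ false × t ≡ x) ⊎ (b t ≡ true × ∃[ tr ] Exits t (root (P t)) tr x)
    to (_ , _ , refl→ , r) with b t
    to (_ , _ , refl→ , refl) | false = inj₁ (refl , refl)
    to (_ , _ , refl→ , ())   | true
    to (_ , _ , sil→ _ q , r) with b t
    to (_ , _ , sil→ () q , r)   | false
    to (tr , _ , sil→ refl q , r) | true = inj₂ (refl , tr , ret⇒Exits q r)
    to (_ , _ , vis→ _ _ q , r) with b t
    to (_ , _ , vis→ () _ q , r) | false
    to (_ , _ , vis→ () _ q , r) | true
    from : ∀ {x} → (b t ≡ false × t ≡ x) ⊎ (b t ≡ true × ∃[ tr ] Exits t (root (P t)) tr x) →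
           retvals (at W (inj₁ t)) x
    from (inj₁ (bt , refl)) = [] , inj₁ t , refl→ , leave bt
    from (inj₂ (bt , tr , ex)) = let y , wy , r = Exits⇒ret ex in tr , y , sil→ (enter bt) wy , r

corollary4p10 : {E S : Set} (b : S → Bool) (P : S → ITree E S) (s : S) →
    ∀ s' → retvals (while b P s) s' ⇔
    ((b s ≡ false × s ≡ s') ⊎
    (∃[ tr ] (b s ≡ true × IterTrans b s P tr s' × b s' ≡ false)))
corollary4p10 b P s s' = mk⇔ to from
  where
  open WhileRuns b P s
  open Iteration b P
  RHS : Set₁
  RHS = (b s ≡ false × s ≡ s') ⊎ (∃[ tr ] (b s ≡ true × IterTrans b s P tr s' × b s' ≡ false))
  to : retvals W s' → RHS
  to r with Equivalence.to retvals-while⇔ r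
  ... | inj₁ stop = inj₁ stop
  ... | inj₂ (bs , tr , ex) = inj₂ (tr , bs , Equivalence.from (IterTrans⇔Exits bs) ex)
  from : RHS → retvals W s'
  from (inj₁ stop) = Equivalence.from retvals-while⇔ (inj₁ stop)
  from (inj₂ (tr , bs , run)) =
    Equivalence.from retvals-while⇔ (inj₂ (bs , tr , Equivalence.to (IterTrans⇔Exits bs) run))
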